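{- Let $y<z$ in $NS_n$, and let $l_1<l_2<\cdots<l_s$ be the labels appearing on the edges of the interval $[y,z]_{\Pi_n}$ of $\Pi_n$ under the edge-labelling $\delta$. Then: (i) there is exactly one $w$ in the interval $[y,z]_{NS_n}$ of $NS_n$ with $y\lessdot w$ in $NS_n$ and $\gamma(y,w)=l_1$; (ii) on any unrefinable chain $y=u_0\lessdot u_1\lessdot\cdots\lessdot u_k=z$ in $NS_n$, the label $l_1$ appears, i.e. $\gamma(u_i,u_{i+1})=l_1$ for some $0\le i<k$.
   Context: $\Pi_n$ is the set of set partitions of $[n]$ ordered by refinement; $z$ covers $y$ in $\Pi_n$ iff $z$ is obtained by merging two blocks $B,B'$ of $y$, and then $\delta(y,z)=\max\{\min B,\min B'\}$. A partition of $[n]$ is non-straddling if whenever a block $B$ contains $a$ and $d$ and a block $B'$ contains $b$ and $c$ with $a<b<c<d$, then $B=B'$. $NS_n$ is the subposet of $\Pi_n$ of non-straddling partitions. If $y\lessdot z$ in $NS_n$, then $z$ is obtained from $y$ by merging some blocks $B_1,\dots,B_r$ of $y$ into one block, and $\gamma(y,z)$ is the second smallest element of $\{\min B_1,\dots,\min B_r\}$. -}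

module Defs where

open import Data.Nat using (ℕ)
open import Data.Fin using (Fin; _≤_; _<_)
open import Data.Product using (Σ; _×_; _,_; ∃)
open import Data.Sum using (_⊎_)
open import Data.Empty using (⊥)
open import Relation.Binary.PropositionalEquality using (_≡_)
open import Relation.Nullary using (¬_)

-- A set partition of [n] = {0,…,n-1} (0-indexed; order is preserved),
-- encoded canonically by the map sending each element to the minimum
-- of its block.
record Partition (n : ℕ) : Set where
  field
    rep     : Fin n → Fin n
    rep-le  : ∀ i → rep i ≤ i
    rep-idem : ∀ i → rep (rep i) ≡ rep i
open Partition public

module _ {n : ℕ} where

  SameBlock : Partition n → Fin n → Fin n → Set
  SameBlock y i j = rep y i ≡ rep y j

  IsBlockMin : Partition n → Fin n → Set
  IsBlockMin y a = rep y a ≡ a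

  _≐_ : Partition n → Partition n → Set
  y ≐ z = ∀ i → rep y i ≡ rep z i

  _⊑_ : Partition n → Partition n → Set
  y ⊑ z = ∀ i j → SameBlock y i j → SameBlock z i j

  _⊏_ : Partition n → Partition n → Set
  y ⊏ z = (y ⊑ z) × ¬ (y ≐ z)

  -- Cover in Π_n: z is obtained from y by merging the two distinct blocks
  -- of y with minima a and b.
  PiCover : Partition n → Partition n → Fin n → Fin n → Set
  PiCover y z a b =
    IsBlockMin y a × IsBlockMin y b × ¬ (a ≡ b) ×
    (∀ i j → SameBlock z i j →
       SameBlock y i j ⊎ ((rep y i ≡ a ⊎ rep y i ≡ b) × (rep y j ≡ a ⊎ rep y j ≡ b))) ×
    (∀ i j → SameBlock y i j ⊎ ((rep y i ≡ a ⊎ rep y i ≡ b) × (rep y j ≡ a ⊎ rep y j ≡ b)) →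
       SameBlock z i j)

  -- δ(y,z) = max{min B, min B'}
  IsMax : Fin n → Fin n → Fin n → Set
  IsMax a b m = (m ≡ a ⊎ m ≡ b) × a ≤ m × b ≤ m

  PiIntervalLabel : Partition n → Partition n → Fin n → Set
  PiIntervalLabel y z l =
    Σ (Partition n) λ u → Σ (Partition n) λ v → Σ (Fin n) λ a → Σ (Fin n) λ b →
      (y ⊑ u) × (v ⊑ z) × PiCover u v a b × IsMax a b l

  MinPiIntervalLabel : Partition n → Partition n → Fin n → Set
  MinPiIntervalLabel y z l =
    PiIntervalLabel y z l × (∀ l' → PiIntervalLabel y z l' → l ≤ l')

  NonStraddling : Partition n → Set
  NonStraddling y = ∀ a b c d → a < b → b < c → c < d →
    SameBlock y a d → SameBlock y b c → SameBlock y a b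

  NSCover : Partition n → Partition n → Set
  NSCover y z = NonStraddling y × NonStraddling z × (y ⊏ z) ×
    (∀ w → NonStraddling w → y ⊏ w → w ⊏ z → ⊥)

  -- γ(y,z) = g: for the block of z (with minimum m) formed by merging blocks
  -- B₁,…,B_r of y (r ≥ 2), the minima of the Bᵢ are the block-minima h of y with
  -- rep z h ≡ m; the smallest is m itself, and g is the second smallest.
  Gamma : Partition n → Partition n → Fin n → Set
  Gamma y z g = Σ (Fin n) λ m →
    IsBlockMin z m × IsBlockMin y m ×
    IsBlockMin y g × rep z g ≡ m × ¬ (g ≡ m) ×
    (∀ h → IsBlockMin y h → rep z h ≡ m → ¬ (h ≡ m) → g ≤ h)

  data NSChain : Partition n → Partition n → Set where
    done : ∀ {y z} → y ≐ z → NSChain y z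
    step : ∀ {y u z} → NSCover y u → NSChain u z → NSChain y z

  data LabelOnChain (l : Fin n) : ∀ {y z} → NSChain y z → Set where
    here  : ∀ {y u z} {c : NSCover y u} {ch : NSChain u z} →
            Gamma y u l → LabelOnChain l {y} {z} (step {y} {u} {z} c ch)
    there : ∀ {y u z} {c : NSCover y u} {ch : NSChain u z} →
            LabelOnChain l {u} {z} ch → LabelOnChain l {y} {z} (step {y} {u} {z} c ch)

{-# OPTIONS --safe #-}

-- Let m be the minimum of the z-block of l₁.  Every edge label of [y,z] in Π_n is the larger of
-- two y-block minima sharing a z-block, so l₁ is a y-block minimum and the smallest one other
-- than m in the z-block of m.  Hence an NS-cover u ⋖ v in [y,z] joining the blocks of m and l₁
-- for the first time has γ(u,v) = l₁, which gives (ii).  For (i), call a block of y forced if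
-- every non-straddling coarsening of y joining m and l₁ must join it to them, and let w₀ merge
-- all forced blocks.  Since z is non-straddling, a block straddled in w₀ lies in the z-block of
-- m, so by minimality its minimum exceeds l₁ and it is forced after all: w₀ is non-straddling.
-- A non-straddling w ⊒ y separating m and l₁ keeps distinct forced blocks apart, so nothing lies
-- strictly between y and w₀; and an NS-cover w of y with γ(y,w) = l₁ joins m and l₁, so it lies
-- above w₀ and equals it.

module Submission where

open import Defs
open import Data.Nat using (ℕ)
open import Data.Fin using (Fin)
open import Data.Product using (Σ; _×_)

open import Data.Fin using (_≤_; _<_)
open import Data.Fin.Properties
  using (_≟_; _<?_; _≤?_; ≤-refl; ≤-trans; ≤-antisym; <-trans; <-irrefl; <-asym; <-cmp; ≤∧≢⇒<; <⇒≢;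
         any?; all?)
open import Data.Fin.Induction using (<-wellFounded)
import Data.Nat.Properties as ℕ
open import Data.Product using (∃; ∃₂; _,_; proj₁; proj₂)
open import Data.Sum using (_⊎_; inj₁; inj₂)
open import Data.Empty using (⊥; ⊥-elim)
open import Function using (_∘_)
open import Induction.WellFounded using (Acc; acc)
open import Relation.Binary.Definitions using (tri<; tri≈; tri>)
open import Relation.Binary.PropositionalEquality
  using (_≡_; _≢_; refl; sym; trans; cong; subst)
open import Relation.Nullary using (¬_; Dec; yes; no)
open import Relation.Nullary.Decidable using (_×-dec_; _⊎-dec_; ¬?; map′)
open import Relation.Unary using (Decidable)

module _ {n : ℕ} where

  ⊑-refl : {y : Partition n} → y ⊑ y
  ⊑-refl i j yij = yij

  ⊑-trans : {x y z : Partition n} → x ⊑ y → y ⊑ z → x ⊑ z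
  ⊑-trans x⊑y y⊑z i j xij = y⊑z i j (x⊑y i j xij)

  SameBlock-rep : (y : Partition n) (i : Fin n) → SameBlock y i (rep y i)
  SameBlock-rep y i = sym (rep-idem y i)

  ⊑-rep : {y z : Partition n} → y ⊑ z → ∀ i → SameBlock z i (rep y i)
  ⊑-rep {y} y⊑z i = y⊑z i (rep y i) (SameBlock-rep y i)

  rep-⊑-≤ : {y z : Partition n} → y ⊑ z → ∀ i → rep z i ≤ rep y i
  rep-⊑-≤ {y} {z} y⊑z i = subst (_≤ rep y i) (sym (⊑-rep {y = y} {z = z} y⊑z i)) (rep-le z (rep y i))

  ⊑-antisym : {y z : Partition n} → y ⊑ z → z ⊑ y → y ≐ z
  ⊑-antisym {y} {z} y⊑z z⊑y i = ≤-antisym (rep-⊑-≤ {y = z} {z = y} z⊑y i) (rep-⊑-≤ {y = y} {z = z} y⊑z i)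

  IsBlockMin-⊑ : {y z : Partition n} → y ⊑ z → ∀ {r} → IsBlockMin z r → IsBlockMin y r
  IsBlockMin-⊑ {y} {z} y⊑z {r} zr =
    ≤-antisym (rep-le y r) (subst (_≤ rep y r) zr (rep-⊑-≤ {y = y} {z = z} y⊑z r))

  NSChain⇒⊑ : {y z : Partition n} → NSChain y z → y ⊑ z
  NSChain⇒⊑ (done y≐z) i j yij = trans (sym (y≐z i)) (trans yij (y≐z j))
  NSChain⇒⊑ (step {y} {u} {z} (_ , _ , (y⊑u , _) , _) ch) =
    ⊑-trans {x = y} {y = u} {z = z} y⊑u (NSChain⇒⊑ ch)

  ≐-sym : {y z : Partition n} → y ≐ z → z ≐ y
  ≐-sym y≐z i = sym (y≐z i)

  _≐?_ : (y z : Partition n) → Dec (y ≐ z)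
  y ≐? z = all? λ i → rep y i ≟ rep z i

  NSCover⇒≐ : {y u w : Partition n} → NSCover y w → NonStraddling u → y ⊏ u → u ⊑ w → u ≐ w
  NSCover⇒≐ {u = u} {w} (_ , _ , _ , nothing-between) nsu y⊏u u⊑w with u ≐? w
  ... | yes u≐w = u≐w
  ... | no u≉w = ⊥-elim (nothing-between u nsu y⊏u (u⊑w , u≉w))

module MergeBlocks {n : ℕ} (y : Partition n) {S : Fin n → Set} (S? : Decidable S)
  {m : Fin n} (ym : IsBlockMin y m) (Sm : S m) (m≤S : ∀ {p} → S p → m ≤ p) where

  collapse : Fin n → Fin n
  collapse p with S? p
  ... | yes _ = m
  ... | no _ = p

  collapse-∈ : ∀ {p} → S p → collapse p ≡ m
  collapse-∈ {p} sp with S? p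
  ... | yes _ = refl
  ... | no ¬sp = ⊥-elim (¬sp sp)

  collapse-∉ : ∀ {p} → ¬ S p → collapse p ≡ p
  collapse-∉ {p} ¬sp with S? p
  ... | yes sp = ⊥-elim (¬sp sp)
  ... | no _ = refl

  merged : Partition n
  merged = record { rep = collapse ∘ rep y ; rep-le = collapse-le ; rep-idem = collapse-idem }
    where
      collapse-le : ∀ i → collapse (rep y i) ≤ i
      collapse-le i with S? (rep y i)
      ... | yes sp = ≤-trans (m≤S sp) (rep-le y i)
      ... | no _ = rep-le y i

      collapse-idem : ∀ i → collapse (rep y (collapse (rep y i))) ≡ collapse (rep y i)
      collapse-idem i with S? (rep y i)
      ... | yes _ = trans (cong collapse ym) (collapse-∈ Sm)
      ... | no ¬sp = trans (cong collapse (rep-idem y i)) (collapse-∉ ¬sp)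

  ⊑-merged : y ⊑ merged
  ⊑-merged i j = cong collapse

  merged-SameBlock : ∀ {i j} → S (rep y i) → S (rep y j) → SameBlock merged i j
  merged-SameBlock si sj = trans (collapse-∈ si) (sym (collapse-∈ sj))

  SameBlock-merged : ∀ {i j} → SameBlock merged i j →
                     (S (rep y i) × S (rep y j)) ⊎ (¬ S (rep y i) × SameBlock y i j)
  SameBlock-merged {i} {j} e = by-cases (S? (rep y i)) (S? (rep y j))
    where
      by-cases : Dec (S (rep y i)) → Dec (S (rep y j)) →
                 (S (rep y i) × S (rep y j)) ⊎ (¬ S (rep y i) × SameBlock y i j)
      by-cases (yes si) (yes sj) = inj₁ (si , sj)
      by-cases (yes si) (no ¬sj) =
        ⊥-elim (¬sj (subst S (trans (sym (collapse-∈ si)) (trans e (collapse-∉ ¬sj))) Sm))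
      by-cases (no ¬si) (yes sj) =
        ⊥-elim (¬si (subst S (trans (sym (collapse-∈ sj)) (trans (sym e) (collapse-∉ ¬si))) Sm))
      by-cases (no ¬si) (no ¬sj) = inj₂ (¬si , trans (sym (collapse-∉ ¬si)) (trans e (collapse-∉ ¬sj)))

  merged-⊑ : (x : Partition n) → y ⊑ x → (∀ {p} → S p → SameBlock x p m) → merged ⊑ x
  merged-⊑ x y⊑x S⊆m i j e with SameBlock-merged e
  ... | inj₂ (_ , yij) = y⊑x i j yij
  ... | inj₁ (si , sj) = trans (in-block-m i si) (sym (in-block-m j sj))
    where
      in-block-m : ∀ k → S (rep y k) → SameBlock x k m
      in-block-m k sk = trans (⊑-rep {y = y} {z = x} y⊑x k) (S⊆m sk)

module _ {n : ℕ} where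

  NonStraddling⇒crossing : {y : Partition n} → NonStraddling y →
    ∀ {p r i j} → p < r → r < i → r < j → SameBlock y p i → SameBlock y r j → ¬ SameBlock y p r → i < j
  NonStraddling⇒crossing nsy {p} {r} {i} {j} p<r r<i r<j pi rj p≁r with <-cmp i j
  ... | tri< i<j _ _ = i<j
  ... | tri≈ _ refl _ = ⊥-elim (p≁r (trans pi (sym rj)))
  ... | tri> _ _ j<i = ⊥-elim (p≁r (nsy p r j i p<r r<j j<i pi rj))

  merge-PiIntervalLabel : {y z : Partition n} → y ⊑ z → ∀ {a b} → IsBlockMin y a → IsBlockMin y b →
                          a < b → SameBlock z a b → PiIntervalLabel y z b
  merge-PiIntervalLabel {y} {z} y⊑z {a} {b} ya yb a<b zab =
    y , merged , a , b , ⊑-refl {y = y} , merged-⊑ z y⊑z a-or-b⊆a ,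
    (ya , yb , <⇒≢ a<b , split , join) , inj₂ refl , ℕ.<⇒≤ a<b , ≤-refl
    where
      a≤ : ∀ {p} → p ≡ a ⊎ p ≡ b → a ≤ p
      a≤ (inj₁ refl) = ≤-refl
      a≤ (inj₂ refl) = ℕ.<⇒≤ a<b

      open MergeBlocks y (λ p → (p ≟ a) ⊎-dec (p ≟ b)) ya (inj₁ refl) a≤

      a-or-b⊆a : ∀ {p} → p ≡ a ⊎ p ≡ b → SameBlock z p a
      a-or-b⊆a (inj₁ refl) = refl
      a-or-b⊆a (inj₂ refl) = sym zab

      split : ∀ i j → SameBlock merged i j →
              SameBlock y i j ⊎ ((rep y i ≡ a ⊎ rep y i ≡ b) × (rep y j ≡ a ⊎ rep y j ≡ b))
      split i j e with SameBlock-merged e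
      ... | inj₁ both = inj₂ both
      ... | inj₂ (_ , yij) = inj₁ yij

      join : ∀ i j → SameBlock y i j ⊎ ((rep y i ≡ a ⊎ rep y i ≡ b) × (rep y j ≡ a ⊎ rep y j ≡ b)) →
             SameBlock merged i j
      join i j (inj₁ yij) = ⊑-merged i j yij
      join i j (inj₂ (si , sj)) = merged-SameBlock si sj

  SameBlock⇒rep< : (z : Partition n) → ∀ {l k} → SameBlock z l k → k < l → rep z l < l
  SameBlock⇒rep< z {l} {k} zlk k<l = ℕ.≤-<-trans (subst (_≤ k) (sym zlk) (rep-le z k)) k<l

  PiIntervalLabel⇒IsBlockMin×rep< : {y z : Partition n} {l : Fin n} → PiIntervalLabel y z l →
                                     IsBlockMin y l × rep z l < l
  PiIntervalLabel⇒IsBlockMin×rep< {y} {z} (u , v , a , b , y⊑u , v⊑z , (ua , ub , a≢b , _ , join) , l-max) =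
    of-max (IsBlockMin-⊑ {y = y} {z = u} y⊑u ua) (IsBlockMin-⊑ {y = y} {z = u} y⊑u ub) a≢b
           (v⊑z a b (join a b (inj₂ (inj₁ ua , inj₂ ub)))) l-max
    where
      of-max : ∀ {a b l} → IsBlockMin y a → IsBlockMin y b → a ≢ b → SameBlock z a b → IsMax a b l →
               IsBlockMin y l × rep z l < l
      of-max ya _ a≢b zab (inj₁ refl , _ , b≤a) = ya , SameBlock⇒rep< z zab (≤∧≢⇒< b≤a (a≢b ∘ sym))
      of-max _ yb a≢b zab (inj₂ refl , a≤b , _) = yb , SameBlock⇒rep< z (sym zab) (≤∧≢⇒< a≤b a≢b)

module Forcing {n : ℕ} {y : Partition n} (nsy : NonStraddling y)
  {m l : Fin n} (m<l : m < l) (ym : IsBlockMin y m) (yl : IsBlockMin y l) where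

  Exceeds : Fin n → Fin n → Set
  Exceeds p c = ∃ λ j → c < j × rep y j ≡ p

  Exceeds? : ∀ p c → Dec (Exceeds p c)
  Exceeds? p c = any? λ j → (c <? j) ×-dec (rep y j ≟ p)

  Exceeds-< : ∀ {p c c′} → c′ < c → Exceeds p c → Exceeds p c′
  Exceeds-< c′<c (j , c<j , yj) = j , <-trans c′<c c<j , yj

  -- In forced-by the blocks of p, q and r all reach past r, so joining the first two
  -- straddles the third.
  data Forced : Fin n → Set where
    forced-m  : Forced m
    forced-l  : Forced l
    forced-by : ∀ {p q r} → IsBlockMin y r → Exceeds r r → p < r → q < r → p ≢ q →
                Forced p → Forced q → Exceeds p r → Exceeds q r → Forced r

  Forced⇒IsBlockMin : ∀ {r} → Forced r → IsBlockMin y r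
  Forced⇒IsBlockMin forced-m = ym
  Forced⇒IsBlockMin forced-l = yl
  Forced⇒IsBlockMin (forced-by yr _ _ _ _ _ _ _ _) = yr

  Forced⇒≡m⊎l≤ : ∀ {r} → Forced r → r ≡ m ⊎ l ≤ r
  Forced⇒≡m⊎l≤ forced-m = inj₁ refl
  Forced⇒≡m⊎l≤ forced-l = inj₂ ≤-refl
  Forced⇒≡m⊎l≤ (forced-by _ _ p<r q<r p≢q fp fq _ _) with Forced⇒≡m⊎l≤ fp | Forced⇒≡m⊎l≤ fq
  ... | inj₂ l≤p | _        = inj₂ (≤-trans l≤p (ℕ.<⇒≤ p<r))
  ... | inj₁ _   | inj₂ l≤q = inj₂ (≤-trans l≤q (ℕ.<⇒≤ q<r))
  ... | inj₁ refl | inj₁ refl = ⊥-elim (p≢q refl)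

  Forced⇒m≤ : ∀ {r} → Forced r → m ≤ r
  Forced⇒m≤ fr with Forced⇒≡m⊎l≤ fr
  ... | inj₁ refl = ≤-refl
  ... | inj₂ l≤r = ≤-trans (ℕ.<⇒≤ m<l) l≤r

  crossing : ∀ {p r i j} → IsBlockMin y p → IsBlockMin y r → p < r →
             r < i → rep y i ≡ p → r < j → rep y j ≡ r → i < j
  crossing yp yr p<r r<i yi r<j yj =
    NonStraddling⇒crossing {y = y} nsy p<r r<i r<j (trans yp (sym yi)) (trans yr (sym yj))
      (λ yp≡yr → <-irrefl (trans (sym yp) (trans yp≡yr yr)) p<r)

  module _ (x : Partition n) (nsx : NonStraddling x) (y⊑x : y ⊑ x) where

    private
      ⊑x : ∀ {i p} → rep y i ≡ p → SameBlock x i p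
      ⊑x {i} yi = trans (⊑-rep {y = y} {z = x} y⊑x i) (cong (rep x) yi)

    join-forced : ∀ {p q r} → IsBlockMin y p → IsBlockMin y q → IsBlockMin y r → Exceeds r r →
                  p < r → q < r → p ≢ q → Exceeds p r → Exceeds q r → SameBlock x p q → SameBlock x r p
    join-forced yp yq yr (k , r<k , yk) p<r q<r p≢q (i , r<i , yi) (j , r<j , yj) xpq
      with <-cmp i j
    ... | tri< i<j _ _ =
      trans (nsx _ i j k r<i i<j (crossing yq yr q<r r<j yj r<k yk) (sym (⊑x yk))
                 (trans (⊑x yi) (trans xpq (sym (⊑x yj)))))
            (⊑x yi)
    ... | tri≈ _ refl _ = ⊥-elim (p≢q (trans (sym yi) yj))
    ... | tri> _ _ j<i =
      trans (nsx _ j i k r<j j<i (crossing yp yr p<r r<i yi r<k yk) (sym (⊑x yk))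
                 (trans (⊑x yj) (trans (sym xpq) (sym (⊑x yi)))))
            (trans (⊑x yj) (sym xpq))

    Forced⇒SameBlock : SameBlock x m l → ∀ {r} → Forced r → SameBlock x r m
    Forced⇒SameBlock xml forced-m = refl
    Forced⇒SameBlock xml forced-l = sym xml
    Forced⇒SameBlock xml (forced-by yr er p<r q<r p≢q fp fq ep eq) =
      trans (join-forced (Forced⇒IsBlockMin fp) (Forced⇒IsBlockMin fq) yr er p<r q<r p≢q ep eq
              (trans (Forced⇒SameBlock xml fp) (sym (Forced⇒SameBlock xml fq))))
            (Forced⇒SameBlock xml fp)

    SameBlock-crossing : ∀ {a p q} → IsBlockMin y a → IsBlockMin y q → a < q → Exceeds a q → Exceeds q q →
                p < q → SameBlock x p q → SameBlock x a q
    SameBlock-crossing {a} {p} {q} ya yq a<q (i , q<i , yi) (j , q<j , yj) p<q xpq with <-cmp p a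
    ... | tri< p<a _ _ =
      trans (sym (nsx p a i j p<a (<-trans a<q q<i) (crossing ya yq a<q q<i yi q<j yj)
                  (trans xpq (sym (⊑x yj))) (sym (⊑x yi))))
            xpq
    ... | tri≈ _ refl _ = xpq
    ... | tri> _ _ a<p = trans (nsx a p q i a<p p<q q<i (sym (⊑x yi)) xpq) xpq

    Forced-separated : ¬ SameBlock x m l → ∀ {p q} → Forced p → Forced q → p ≢ q → ¬ SameBlock x p q
    Forced-separated-< : ¬ SameBlock x m l → ∀ {p q} → Forced p → Forced q → p < q → ¬ SameBlock x p q

    Forced-separated x≁ml {p} {q} fp fq p≢q with <-cmp p q
    ... | tri< p<q _ _ = Forced-separated-< x≁ml fp fq p<q
    ... | tri≈ _ p≡q _ = ⊥-elim (p≢q p≡q)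
    ... | tri> _ _ q<p = Forced-separated-< x≁ml fq fp q<p ∘ sym

    Forced-separated-< x≁ml fp forced-m p<m _ = ℕ.≤⇒≯ (Forced⇒m≤ fp) p<m
    Forced-separated-< x≁ml fp forced-l p<l xpl with Forced⇒≡m⊎l≤ fp
    ... | inj₁ refl = x≁ml xpl
    ... | inj₂ l≤p = ℕ.≤⇒≯ l≤p p<l
    Forced-separated-< x≁ml fp (forced-by yq eq q₁<q q₂<q q₁≢q₂ fq₁ fq₂ e₁ e₂) p<q xpq =
      Forced-separated x≁ml fq₁ fq₂ q₁≢q₂
        (trans (SameBlock-crossing (Forced⇒IsBlockMin fq₁) yq q₁<q e₁ eq p<q xpq)
               (sym (SameBlock-crossing (Forced⇒IsBlockMin fq₂) yq q₂<q e₂ eq p<q xpq)))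

  Forced-exceeding⇒Forced-≤ : ∀ {p c} → Forced p → l < c → Exceeds p c →
                              ∃ λ q → Forced q × q ≤ c × Exceeds q c
  Forced-exceeding⇒Forced-≤ {p} {c} fp l<c ep with p ≤? c
  ... | yes p≤c = p , fp , p≤c , ep
  Forced-exceeding⇒Forced-≤ forced-m l<c _ | no m≰c = ⊥-elim (m≰c (ℕ.<⇒≤ (<-trans m<l l<c)))
  Forced-exceeding⇒Forced-≤ forced-l l<c _ | no l≰c = ⊥-elim (l≰c (ℕ.<⇒≤ l<c))
  Forced-exceeding⇒Forced-≤ (forced-by _ _ _ _ _ fp₁ _ e₁ _) l<c _ | no p≰c =
    Forced-exceeding⇒Forced-≤ fp₁ l<c (Exceeds-< (ℕ.≰⇒> p≰c) e₁)

  Forced-inside⇒Forced : ∀ {a d q} → SameBlock y a d → l < rep y a →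
                         Forced q → rep y a < q → q < d → Forced (rep y a)
  Forced-inside⇒Forced yad l<x forced-m x<m _ = ⊥-elim (<-asym (<-trans m<l l<x) x<m)
  Forced-inside⇒Forced yad l<x forced-l x<l _ = ⊥-elim (<-asym l<x x<l)
  Forced-inside⇒Forced {a} {d} yad l<x (forced-by {q₁} {q₂} _ _ q₁<q q₂<q q₁≢q₂ fq₁ fq₂ e₁ e₂) x<q q<d
    with <-cmp q₁ (rep y a) | <-cmp q₂ (rep y a)
  ... | tri≈ _ q₁≡x _ | _ = subst Forced q₁≡x fq₁
  ... | tri> _ _ x<q₁ | _ = Forced-inside⇒Forced yad l<x fq₁ x<q₁ (<-trans q₁<q q<d)
  ... | tri< _ _ _ | tri≈ _ q₂≡x _ = subst Forced q₂≡x fq₂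
  ... | tri< _ _ _ | tri> _ _ x<q₂ = Forced-inside⇒Forced yad l<x fq₂ x<q₂ (<-trans q₂<q q<d)
  ... | tri< q₁<x _ _ | tri< q₂<x _ _ =
    forced-by (rep-idem y a) (d , <-trans x<q q<d , sym yad) q₁<x q₂<x q₁≢q₂ fq₁ fq₂
      (Exceeds-< x<q e₁) (Exceeds-< x<q e₂)

  Forced-beyond⇒Forced : ∀ {b c d} → b < c → c < d → SameBlock y b c → l < rep y b →
                         Forced (rep y d) → Forced (rep y b)
  Forced-beyond⇒Forced {b} {c} {d} b<c c<d ybc l<x fd
    with Forced-exceeding⇒Forced-≤ fd (<-trans l<x (ℕ.≤-<-trans (rep-le y b) b<c)) (d , c<d , refl)
  ... | p , fp , p≤c , e , c<e , ye with <-cmp p b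
  ...   | tri< p<b _ _ = subst Forced (trans (sym yp) (nsy p b c e p<b b<c c<e (trans yp (sym ye)) ybc)) fp
    where
      yp : IsBlockMin y p
      yp = Forced⇒IsBlockMin fp
  ...   | tri≈ _ refl _ = subst Forced (sym (Forced⇒IsBlockMin fp)) fp
  ...   | tri> _ _ b<p with <-cmp p c
  ...     | tri< p<c _ _ = Forced-inside⇒Forced ybc l<x fp (ℕ.≤-<-trans (rep-le y b) b<p) p<c
  ...     | tri≈ _ refl _ = subst Forced (trans (sym (Forced⇒IsBlockMin fp)) (sym ybc)) fp
  ...     | tri> _ _ c<p = ⊥-elim (ℕ.≤⇒≯ p≤c c<p)

  Forced-within⇒Forced : ∀ {a b c d} → a < b → b < c → c < d → SameBlock y a d → l < rep y a →
                         Forced (rep y b) → Forced (rep y c) → Forced (rep y a)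
  Forced-within⇒Forced {a} {b} {c} {d} a<b b<c c<d yad l<x fb fc with rep y b ≟ rep y c
  ... | yes ybc = subst Forced (sym (nsy a b c d a<b b<c c<d yad ybc)) fb
  ... | no p≢q with <-cmp (rep y b) (rep y a) | <-cmp (rep y c) (rep y a)
  ...   | tri≈ _ p≡x _ | _ = subst Forced p≡x fb
  ...   | tri> _ _ x<p | _ =
    Forced-inside⇒Forced yad l<x fb x<p (ℕ.≤-<-trans (rep-le y b) (<-trans b<c c<d))
  ...   | tri< _ _ _ | tri≈ _ q≡x _ = subst Forced q≡x fc
  ...   | tri< _ _ _ | tri> _ _ x<q =
    Forced-inside⇒Forced yad l<x fc x<q (ℕ.≤-<-trans (rep-le y c) c<d)
  ...   | tri< p<x _ _ | tri< q<x _ _ =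
    forced-by (rep-idem y a) (d , x<d , sym yad) p<x q<x p≢q fb fc
      (b , x<b , refl) (c , <-trans x<b b<c , refl)
    where
      x<b : rep y a < b
      x<b = ℕ.≤-<-trans (rep-le y a) a<b
      x<d : rep y a < d
      x<d = <-trans x<b (<-trans b<c c<d)

  private
    ForcedPair : Fin n → Fin n → Fin n → Set
    ForcedPair r p q = p < r × q < r × p ≢ q × Forced p × Forced q × Exceeds p r × Exceeds q r

    ForcedBy : Fin n → Set
    ForcedBy r = IsBlockMin y r × Exceeds r r × ∃₂ (ForcedPair r)

    ForcedBy⇒Forced : ∀ {r} → ForcedBy r → Forced r
    ForcedBy⇒Forced (yr , er , _ , _ , p<r , q<r , p≢q , fp , fq , ep , eq) =
      forced-by yr er p<r q<r p≢q fp fq ep eq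

    Forced⇒ForcedBy : ∀ {r} → r ≢ m → r ≢ l → Forced r → ForcedBy r
    Forced⇒ForcedBy m≢m _ forced-m = ⊥-elim (m≢m refl)
    Forced⇒ForcedBy _ l≢l forced-l = ⊥-elim (l≢l refl)
    Forced⇒ForcedBy _ _ (forced-by yr er p<r q<r p≢q fp fq ep eq) =
      yr , er , _ , _ , p<r , q<r , p≢q , fp , fq , ep , eq

    ForcedBy? : ∀ {r} → (∀ {p} → p < r → Dec (Forced p)) → Dec (ForcedBy r)
    ForcedBy? {r} Forced<? = (rep y r ≟ r) ×-dec Exceeds? r r ×-dec any? λ p → any? λ q → ForcedPair? p q
      where
        ForcedPair? : ∀ p q → Dec (ForcedPair r p q)
        ForcedPair? p q with p <? r | q <? r
        ... | no p≮r | _ = no (p≮r ∘ proj₁)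
        ... | yes _ | no q≮r = no (q≮r ∘ proj₁ ∘ proj₂)
        ... | yes p<r | yes q<r =
          map′ (λ rest → p<r , q<r , rest) (proj₂ ∘ proj₂)
            (¬? (p ≟ q) ×-dec Forced<? p<r ×-dec Forced<? q<r ×-dec Exceeds? p r ×-dec Exceeds? q r)

    Forced-acc? : ∀ {r} → Acc _<_ r → Dec (Forced r)
    Forced-acc? {r} (acc rs) with r ≟ m | r ≟ l
    ... | yes refl | _ = yes forced-m
    ... | no _ | yes refl = yes forced-l
    ... | no r≢m | no r≢l =
      map′ ForcedBy⇒Forced (Forced⇒ForcedBy r≢m r≢l) (ForcedBy? (λ p<r → Forced-acc? (rs p<r)))

  Forced? : Decidable Forced
  Forced? r = Forced-acc? (<-wellFounded r)

module MinimalLabel {n : ℕ} {y z : Partition n} (nsy : NonStraddling y) (nsz : NonStraddling z)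
  (y⊑z : y ⊑ z) {l : Fin n} (l-label : PiIntervalLabel y z l)
  (l-min : ∀ l′ → PiIntervalLabel y z l′ → l ≤ l′) where

  m : Fin n
  m = rep z l

  zm : IsBlockMin z m
  zm = rep-idem z l

  ym : IsBlockMin y m
  ym = IsBlockMin-⊑ {y = y} {z = z} y⊑z zm

  yl : IsBlockMin y l
  yl = proj₁ (PiIntervalLabel⇒IsBlockMin×rep< {y = y} {z = z} l-label)

  m<l : m < l
  m<l = proj₂ (PiIntervalLabel⇒IsBlockMin×rep< {y = y} {z = z} l-label)

  l-second : ∀ {h} → IsBlockMin y h → rep z h ≡ m → h ≢ m → l ≤ h
  l-second {h} yh zh h≢m = l-min h (merge-PiIntervalLabel {y = y} {z = z} y⊑z ym yh m<h (trans zm (sym zh)))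
    where
      m<h : m < h
      m<h = ≤∧≢⇒< (subst (_≤ h) zh (rep-le z h)) (h≢m ∘ sym)

  open Forcing {y = y} nsy m<l ym yl

  Forced⇒rep-z : ∀ {r} → Forced r → rep z r ≡ m
  Forced⇒rep-z fr = trans (Forced⇒SameBlock z nsz y⊑z zm fr) zm

  open MergeBlocks y Forced? ym forced-m Forced⇒m≤

  w₀ : Partition n
  w₀ = merged

  w₀⊑z : w₀ ⊑ z
  w₀⊑z = merged-⊑ z y⊑z (λ fp → trans (Forced⇒rep-z fp) (sym zm))

  Unforced⇒l< : ∀ {i j} → SameBlock z i j → Forced (rep y j) → ¬ Forced (rep y i) → l < rep y i
  Unforced⇒l< {i} {j} zij fj ¬fi = ≤∧≢⇒< (l-second (rep-idem y i) zx x≢m) l≢x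
    where
      zx : rep z (rep y i) ≡ m
      zx = trans (sym (⊑-rep {y = y} {z = z} y⊑z i))
                 (trans zij (trans (⊑-rep {y = y} {z = z} y⊑z j) (Forced⇒rep-z fj)))
      x≢m : rep y i ≢ m
      x≢m x≡m = ¬fi (subst Forced (sym x≡m) forced-m)
      l≢x : l ≢ rep y i
      l≢x l≡x = ¬fi (subst Forced l≡x forced-l)

  NonStraddling-w₀ : NonStraddling w₀
  NonStraddling-w₀ a b c d a<b b<c c<d wad wbc
    with SameBlock-merged wad | SameBlock-merged wbc | nsz a b c d a<b b<c c<d (w₀⊑z a d wad) (w₀⊑z b c wbc)
  ... | inj₁ (fa , _) | inj₁ (fb , _) | _ = merged-SameBlock fa fb
  ... | inj₂ (_ , yad) | inj₂ (_ , ybc) | _ = ⊑-merged a b (nsy a b c d a<b b<c c<d yad ybc)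
  ... | inj₁ (fa , fd) | inj₂ (¬fb , ybc) | zab =
    ⊥-elim (¬fb (Forced-beyond⇒Forced b<c c<d ybc (Unforced⇒l< (sym zab) fa ¬fb) fd))
  ... | inj₂ (¬fa , yad) | inj₁ (fb , fc) | zab =
    ⊥-elim (¬fa (Forced-within⇒Forced a<b b<c c<d yad (Unforced⇒l< zab fb ¬fa) fb fc))

  y≁ml : ¬ SameBlock y m l
  y≁ml yml = <⇒≢ m<l (trans (sym ym) (trans yml yl))

  w₀ml : SameBlock w₀ m l
  w₀ml = merged-SameBlock (subst Forced (sym ym) forced-m) (subst Forced (sym yl) forced-l)

  y⊏w₀ : y ⊏ w₀
  y⊏w₀ = ⊑-merged , λ y≐w₀ → y≁ml (trans (y≐w₀ m) (trans w₀ml (sym (y≐w₀ l))))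

  w₀-least : (x : Partition n) → NonStraddling x → y ⊑ x → SameBlock x m l → w₀ ⊑ x
  w₀-least x nsx y⊑x xml = merged-⊑ x y⊑x (Forced⇒SameBlock x nsx y⊑x xml)

  ⊑w₀-separating⇒⊑y : (w : Partition n) → NonStraddling w → y ⊑ w → w ⊑ w₀ → ¬ SameBlock w m l → w ⊑ y
  ⊑w₀-separating⇒⊑y w nsw y⊑w w⊑w₀ w≁ml i j wij with SameBlock-merged (w⊑w₀ i j wij)
  ... | inj₂ (_ , yij) = yij
  ... | inj₁ (fi , fj) with rep y i ≟ rep y j
  ...   | yes yij = yij
  ...   | no yi≢yj = ⊥-elim (Forced-separated w nsw y⊑w w≁ml fi fj yi≢yj
                      (trans (sym (⊑-rep {y = y} {z = w} y⊑w i)) (trans wij (⊑-rep {y = y} {z = w} y⊑w j))))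

  NSCover-w₀ : NSCover y w₀
  NSCover-w₀ = nsy , NonStraddling-w₀ , y⊏w₀ , nothing-between
    where
      nothing-between : ∀ w → NonStraddling w → y ⊏ w → w ⊏ w₀ → ⊥
      nothing-between w nsw (y⊑w , y≉w) (w⊑w₀ , w≉w₀) with rep w m ≟ rep w l
      ... | yes wml = w≉w₀ (⊑-antisym {y = w} {z = w₀} w⊑w₀ (w₀-least w nsw y⊑w wml))
      ... | no w≁ml = y≉w (⊑-antisym {y = y} {z = w} y⊑w (⊑w₀-separating⇒⊑y w nsw y⊑w w⊑w₀ w≁ml))

  Gamma-first-join : (u v : Partition n) → y ⊑ u → u ⊑ v → v ⊑ z →
                     ¬ SameBlock u m l → SameBlock v m l → Gamma u v l
  Gamma-first-join u v y⊑u u⊑v v⊑z u≁ml vml = m , vm , um , ul , trans (sym vml) vm , <⇒≢ m<l ∘ sym , second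
    where
      u⊑z : u ⊑ z
      u⊑z = ⊑-trans {x = u} {y = v} {z = z} u⊑v v⊑z
      vm : IsBlockMin v m
      vm = IsBlockMin-⊑ {y = v} {z = z} v⊑z zm
      um : IsBlockMin u m
      um = IsBlockMin-⊑ {y = u} {z = z} u⊑z zm
      ul : IsBlockMin u l
      ul = ≤-antisym (rep-le u l)
             (l-second (IsBlockMin-⊑ {y = y} {z = u} y⊑u (rep-idem u l)) (sym (⊑-rep {y = u} {z = z} u⊑z l))
                       (λ ul≡m → u≁ml (trans um (sym ul≡m))))
      second : ∀ h → IsBlockMin u h → rep v h ≡ m → h ≢ m → l ≤ h
      second h uh vh h≢m =
        l-second (IsBlockMin-⊑ {y = y} {z = u} y⊑u uh) (trans (v⊑z h m (trans vh (sym vm))) zm) h≢m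

  Gamma-w₀ : Gamma y w₀ l
  Gamma-w₀ = Gamma-first-join y w₀ (⊑-refl {y = y}) ⊑-merged w₀⊑z y≁ml w₀ml

  w₀-unique : ∀ w′ → NonStraddling w′ → w′ ⊑ z → NSCover y w′ → Gamma y w′ l → w′ ≐ w₀
  w₀-unique w′ nsw′ w′⊑z w′-cover@(_ , _ , (y⊑w′ , _) , _) (m′ , w′m′ , ym′ , _ , w′l , l≢m′ , _) =
    ≐-sym {y = w₀} {z = w′} w₀≐w′
    where
      m′<l : m′ < l
      m′<l = ≤∧≢⇒< (subst (_≤ l) w′l (rep-le w′ l)) (l≢m′ ∘ sym)
      m′≡m : m′ ≡ m
      m′≡m with m′ ≟ m
      ... | yes m′≡m = m′≡m
      ... | no m′≢m = ⊥-elim (ℕ.<⇒≱ m′<l (l-second ym′ (w′⊑z m′ l (trans w′m′ (sym w′l))) m′≢m))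
      w′ml : SameBlock w′ m l
      w′ml = subst (λ k → rep w′ k ≡ rep w′ l) m′≡m (trans w′m′ (sym w′l))
      w₀≐w′ : w₀ ≐ w′
      w₀≐w′ = NSCover⇒≐ {y = y} {u = w₀} {w = w′} w′-cover NonStraddling-w₀ y⊏w₀
                (w₀-least w′ nsw′ y⊑w′ w′ml)

  LabelOnChain-from : ∀ {u} (ch : NSChain u z) → y ⊑ u → ¬ SameBlock u m l → LabelOnChain l ch
  LabelOnChain-from (done u≐z) _ u≁ml = ⊥-elim (u≁ml (trans (u≐z m) (trans zm (sym (u≐z l)))))
  LabelOnChain-from {u} (step {u = v} (_ , _ , (u⊑v , _) , _) ch) y⊑u u≁ml with rep v m ≟ rep v l
  ... | yes vml = here (Gamma-first-join u v y⊑u u⊑v (NSChain⇒⊑ ch) u≁ml vml)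
  ... | no v≁ml = there (LabelOnChain-from ch (⊑-trans {x = y} {y = u} {z = v} y⊑u u⊑v) v≁ml)

lemma12 : ∀ {n : ℕ} (y z : Partition n) → NonStraddling y → NonStraddling z → y ⊏ z →
    (l₁ : Fin n) → MinPiIntervalLabel y z l₁ →
    (Σ (Partition n) λ w → (NonStraddling w × w ⊑ z × NSCover y w × Gamma y w l₁) ×
       (∀ w' → NonStraddling w' → w' ⊑ z → NSCover y w' → Gamma y w' l₁ → w' ≐ w))
    × (∀ (ch : NSChain y z) → LabelOnChain l₁ ch)
lemma12 y z nsy nsz (y⊑z , _) l₁ (l₁-label , l₁-min) =
  (w₀ , (NonStraddling-w₀ , w₀⊑z , NSCover-w₀ , Gamma-w₀) , w₀-unique) ,
  λ ch → LabelOnChain-from ch (⊑-refl {y = y}) y≁ml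
  where open MinimalLabel {y = y} {z = z} nsy nsz y⊑z l₁-label l₁-min
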